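{- If an $n$-cbc $X$ is bordered by $(P,Q)$ where $p:=|P|$ is coprime to $q:=|Q|$, then the factorization $\bigl(q\{0,1,\dots,p-1\},\ p\{0,1,\dots,q-1\}\bigr)$ borders $X$.
   Context: Fix an alphabet $\mathcal A$ containing distinct letters $a,b$. A code is a set $X\subseteq\mathcal A^*$ such that $x_1\cdots x_t=y_1\cdots y_{t'}$ with $x_i,y_i\in X$ implies $t=t'$ and $x_i=y_i$ for all $i$. Write $[n]=\{0,\dots,n-1\}$, $a^U=\{a^u:u\in U\}$, $dU=\{du:u\in U\}$. An $n$-cbc is a set $X\subseteq a^{[n]}ba^{[n]}$ with $|X|=n$ such that $\{a^n\}\cup X$ is a code. For $X\subseteq\mathcal A^*$, $\underline X=\sum_{x\in X}x$ in $\mathbb Z\langle\langle\mathcal A\rangle\rangle$; $\equiv_n$ is the congruence generated by $a^n=\varepsilon$. For finite $P,Q\subseteq\mathbb Z$, $(P,Q)$ borders an $n$-cbc $X$ if $\underline{a^P}\,\underline X\,\underline{a^Q}\equiv_n\sum_{i,j\in[n]}a^iba^j$. A pair $(P,Q)$ of sets of integers is a factorization of size $n$ if every $k\in[n]$ can be written in exactly one way as $k\equiv p+q\pmod n$ with $p\in P,q\in Q$. -}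

module Defs where

open import Data.Nat using (ℕ; zero; suc; _*_)
open import Data.Nat.Divisibility using (_∣_; _∣?_)
open import Data.Integer using (ℤ; +_; ∣_∣; _-_) renaming (_+_ to _+ℤ_)
open import Data.Fin using (Fin; toℕ)
open import Data.List using (List; []; _∷_; _++_; replicate; concat; map; length; filter; upTo; concatMap)
open import Data.List.Relation.Unary.All using (All)
open import Data.List.Membership.Propositional using (_∈_)
open import Data.List.Relation.Unary.Unique.Propositional using (Unique)
open import Data.Product using (_×_; _,_; Σ)
open import Relation.Binary.PropositionalEquality using (_≡_)
open import Relation.Nullary using (Dec; yes; no)
open import Relation.Nullary.Decidable using (_×-dec_)

Word : Set → Set
Word A = List A

IsCode : {A : Set} → List (Word A) → Set
IsCode {A} C = (xs ys : List (Word A)) → All (_∈ C) xs → All (_∈ C) ys →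
               concat xs ≡ concat ys → xs ≡ ys

aiba : {A : Set} → A → A → ℕ → ℕ → Word A
aiba a b i j = replicate i a ++ (b ∷ replicate j a)

-- A subset X of a^[n] b a^[n] is represented by the list of exponent pairs (i , j)
-- with i , j ∈ [n] = Fin n, standing for the words a^i b a^j.
cbcWords : {A : Set} → A → A → (n : ℕ) → List (Fin n × Fin n) → List (Word A)
cbcWords a b n X = map (λ ij → aiba a b (toℕ (Data.Product.proj₁ ij)) (toℕ (Data.Product.proj₂ ij))) X
  where import Data.Product

-- X is an n-cbc: X ⊆ a^[n] b a^[n] (built in), |X| = n, and {a^n} ∪ X is a code.
IsCbc : {A : Set} → A → A → (n : ℕ) → List (Fin n × Fin n) → Set
IsCbc a b n X = Unique X × length X ≡ n × IsCode (replicate n a ∷ cbcWords a b n X)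

_≡[_]_ : ℤ → ℕ → ℤ → Set
x ≡[ n ] y = n ∣ ∣ x - y ∣

_≡[_]?_ : (x : ℤ) (n : ℕ) (y : ℤ) → Dec (x ≡[ n ] y)
x ≡[ n ]? y = n ∣? ∣ x - y ∣

-- Coefficient of a^i b a^j (i , j ∈ [n]) in the reduction modulo a^n = ε of
-- the product  a^P · X · a^Q  in Z<<A>>: the number of triples
-- (p , a^k b a^l , q) ∈ P × X × Q with p + k ≡ i and l + q ≡ j (mod n).
coeff : (n : ℕ) → List ℤ → List (Fin n × Fin n) → List ℤ → Fin n → Fin n → ℕ
coeff n P X Q i j =
  length (filter (λ t → ((p t +ℤ k t) ≡[ n ]? (+ toℕ i)) ×-dec ((l t +ℤ q t) ≡[ n ]? (+ toℕ j)))
                 (concatMap (λ p → concatMap (λ x → map (λ q → (p , x , q)) Q) X) P))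
  where
    p : ℤ × (Fin n × Fin n) × ℤ → ℤ
    p (p₀ , _ , _) = p₀
    k : ℤ × (Fin n × Fin n) × ℤ → ℤ
    k (_ , (k₀ , _) , _) = + toℕ k₀
    l : ℤ × (Fin n × Fin n) × ℤ → ℤ
    l (_ , (_ , l₀) , _) = + toℕ l₀
    q : ℤ × (Fin n × Fin n) × ℤ → ℤ
    q (_ , _ , q₀) = q₀

-- (P , Q) borders X:  a^P · X · a^Q ≡_n Σ_{i,j ∈ [n]} a^i b a^j,
-- i.e. every a^i b a^j (i , j ∈ [n]) has coefficient exactly 1 after reduction
-- (all words of the product reduce to some such a^i b a^j).
Borders : (n : ℕ) → List ℤ → List (Fin n × Fin n) → List ℤ → Set
Borders n P X Q = (i j : Fin n) → coeff n P X Q i j ≡ 1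

IsFactorization : ℕ → List ℤ → List ℤ → Set
IsFactorization n P Q = (k : Fin n) →
  length (filter (λ pq → (Data.Product.proj₁ pq +ℤ Data.Product.proj₂ pq) ≡[ n ]? (+ toℕ k))
                 (concatMap (λ p → map (λ q → (p , q)) Q) P)) ≡ 1
  where import Data.Product

scaledRange : ℕ → ℕ → List ℤ
scaledRange c m = map (λ i → + (c * i)) (upTo m)

-- Read the product a^P X a^Q column by column.  For j ∈ [n] let W_j be the multiset of exponents
-- k of the words a^k b a^l ∈ X which, followed by some a^q (q ∈ Q), reduce to a suffix a^j; then
-- (P, Q) borders X exactly when P ⊕ W_j tiles ℤ/nℤ for every j, and symmetrically for rows.  As
-- the W_j partition X × Q, summing |P| |W_j| = n over j gives |P| |Q| = n.
--
-- The key tool is Tijdeman's multiplier theorem: if A ⊕ K tiles ℤ/nℤ and m is coprime to |A|, so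
-- does mA ⊕ K.  For a prime r, finite multisets of integers compared by their residue counts
-- modulo r form a commutative semiring of characteristic r, so A^r ≈ rA by the binomial theorem.
-- Since A^(r-1) ⊕ (A ⊕ K) covers every residue |A|^(r-1) times, every residue count of rA ⊕ K is
-- nonzero modulo r; as |rA ⊕ K| = n, all counts are 1.
--
-- With n = qp, replacing each a ∈ P by a mod p does not change qa modulo n, so if qP ⊕ W_j tiles,
-- so does q[p] ⊕ W_j.  This moves P to q[p] column by column, then Q to p[q] row by row; and
-- multiplying the left factor of [p] ⊕ p[q] = ℤ/nℤ by q gives the factorization q[p] ⊕ p[q].

{-# OPTIONS --safe #-}
module Submission where

open import Defs
open import Data.Nat as ℕ using (ℕ; zero; suc; _∸_; _%_; _≤_; _<_; z≤n; s≤s; NonZero; _!)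
import Data.Nat.Properties as ℕ
import Data.Nat.DivMod as ℕ
open import Data.Nat.Divisibility using (_∣_; _∣?_; _∣0; divides; >⇒∤; ∣⇒≤; ∣1⇒≡1; m∣m*n; ∣n⇒∣m*n; m%n≡0⇒n∣m; n∣m⇒m%n≡0)
open import Data.Nat.Coprimality as Coprime using (Coprime)
open import Data.Nat.Primality using (Prime; euclidsLemma; prime⇒nonZero; prime⇒nonTrivial)
open import Data.Nat.Primality.Factorisation using (factorise; PrimeFactorisation)
open import Data.Nat.Combinatorics using (_C_; nCn≡1; nCk≡n!/k![n-k]!; k![n∸k]!∣n!)
open import Data.Nat.ListAction using (product)
open import Data.Integer as ℤ using (ℤ; +_; ∣_∣; _-_) renaming (_+_ to _+ℤ_; _*_ to _*ℤ_)
import Data.Integer.Properties as ℤ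
open import Data.Integer.Divisibility.Signed as ℤ using (∣ᵤ⇒∣; ∣⇒∣ᵤ; ∣m∣n⇒∣m+n)
open import Data.Integer.DivMod using (_%ℕ_; _/ℕ_; n%ℕd<d; a≡a%ℕn+[a/ℕn]*n)
open import Data.Integer.Tactic.RingSolver using (solve-∀)
open import Data.Fin as Fin using (Fin; toℕ; fromℕ; fromℕ<; inject₁)
import Data.Fin.Properties as Fin
open import Data.List using (List; []; _∷_; [_]; _++_; map; concatMap; length; filter; cartesianProductWith; cartesianProduct; allFin; upTo)
import Data.List.Properties as List
open import Data.List.Membership.Propositional using (_∈_)
import Data.List.Membership.Propositional.Properties as ∈
open import Data.List.Relation.Unary.Any using (here; there)
open import Data.List.Relation.Unary.All using (All; []; _∷_)
open import Data.List.Relation.Unary.Unique.Propositional using (Unique)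
open import Data.Product using (_×_; _,_; ∃; proj₁; proj₂)
open import Data.Sum using (inj₁; inj₂)
open import Function using (_∘_; _⇔_; mk⇔; Equivalence)
open import Relation.Binary.PropositionalEquality using (_≡_; _≢_; refl; sym; trans; cong; cong₂; subst; module ≡-Reasoning)
open import Relation.Nullary using (Dec; yes; no; ¬_; contradiction)
open import Relation.Nullary.Decidable using (_×-dec_)
open import Algebra.Bundles using (CommutativeSemiring)
open import Algebra.Structures using (IsCommutativeSemiring)
open import Algebra.Properties.CommutativeSemigroup ℕ.+-commutativeSemigroup using () renaming (interchange to +-interchange)
open import Algebra.Properties.CommutativeSemigroup ℕ.*-commutativeSemigroup using (x∙yz≈y∙xz)

-- Binomial coefficients modulo a prime and the freshman's dream

prime≢1 : ∀ {p} → Prime p → p ≢ 1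
prime≢1 {p} pr p≡1 = ℕ.<⇒≢ (ℕ.nonTrivial⇒n>1 p {{prime⇒nonTrivial pr}}) (sym p≡1)

prime∤m! : ∀ {p} → Prime p → ∀ m → m < p → ¬ (p ∣ m !)
prime∤m! pr zero    _   p∣1  = prime≢1 pr (∣1⇒≡1 p∣1)
prime∤m! pr (suc m) m<p p∣m! with euclidsLemma (suc m) (m !) pr p∣m!
... | inj₁ p∣m+1 = ℕ.<⇒≱ m<p (∣⇒≤ p∣m+1)
... | inj₂ p∣m!  = prime∤m! pr m (ℕ.<-trans (ℕ.n<1+n m) m<p) p∣m!

p∣p! : ∀ p → .{{NonZero p}} → p ∣ p !
p∣p! (suc p) = m∣m*n (p !)

pCk*k!*[p-k]!≡p! : ∀ {p k} → k ≤ p → (p C k) ℕ.* (k ! ℕ.* (p ∸ k) !) ≡ p !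
pCk*k!*[p-k]!≡p! {p} {k} k≤p = begin
  (p C k) ℕ.* (k ! ℕ.* (p ∸ k) !)
    ≡⟨ cong (ℕ._* (k ! ℕ.* (p ∸ k) !)) (nCk≡n!/k![n-k]! k≤p) ⟩
  p ! ℕ./ (k ! ℕ.* (p ∸ k) !) ℕ.* (k ! ℕ.* (p ∸ k) !)
    ≡⟨ ℕ.m/n*n≡m (k![n∸k]!∣n! k≤p) ⟩
  p ! ∎
  where
  open ≡-Reasoning
  instance
    k!*[p-k]!≢0 : NonZero (k ! ℕ.* (p ∸ k) !)
    k!*[p-k]!≢0 = k ℕ.!* (p ∸ k) !≢0

prime∣pCk : ∀ {p} → Prime p → ∀ {k} → 0 < k → k < p → p ∣ p C k
prime∣pCk {p} pr {k} 0<k k<p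
  with euclidsLemma (p C k) (k ! ℕ.* (p ∸ k) !) pr
         (subst (p ∣_) (sym (pCk*k!*[p-k]!≡p! (ℕ.<⇒≤ k<p))) (p∣p! p {{prime⇒nonZero pr}}))
... | inj₁ p∣pCk = p∣pCk
... | inj₂ p∣k!*[p-k]! with euclidsLemma (k !) ((p ∸ k) !) pr p∣k!*[p-k]!
...   | inj₁ p∣k!     = contradiction p∣k! (prime∤m! pr k k<p)
...   | inj₂ p∣[p-k]! =
  contradiction p∣[p-k]! (prime∤m! pr (p ∸ k) (ℕ.∸-monoʳ-< 0<k (ℕ.<⇒≤ k<p)))

prime∣m^k⇒prime∣m : ∀ {p} → Prime p → ∀ m k → p ∣ m ℕ.^ k → p ∣ m
prime∣m^k⇒prime∣m pr m zero    p∣1 = contradiction (∣1⇒≡1 p∣1) (prime≢1 pr)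
prime∣m^k⇒prime∣m pr m (suc k) p∣m*m^k with euclidsLemma m (m ℕ.^ k) pr p∣m*m^k
... | inj₁ p∣m   = p∣m
... | inj₂ p∣m^k = prime∣m^k⇒prime∣m pr m k p∣m^k

module _ {c ℓ} (S : CommutativeSemiring c ℓ) where
  open CommutativeSemiring S renaming (trans to ≈-trans)
  open import Algebra.Properties.Semiring.Exp semiring using (_^_)
  open import Algebra.Properties.Semiring.Mult semiring
    using (×-congˡ; ×-assocˡ; ×-homo-1) renaming (_×_ to _·_)
  open import Algebra.Properties.Monoid.Sum +-monoid using (sum; sum-init-last; sum-cong-≋; sum-replicate-zero)
  import Algebra.Properties.CommutativeSemiring.Binomial S as Binomial
  open import Relation.Binary.Reasoning.Setoid setoid

  [x+y]^p≈x^p+y^p : ∀ {p} → Prime p → (∀ z → p · z ≈ 0#) → ∀ x y → (x + y) ^ p ≈ x ^ p + y ^ p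
  [x+y]^p≈x^p+y^p {p@(suc p-1)} pr p·≈0 x y = begin
    (x + y) ^ p                                  ≈⟨ Binomial.theorem p x y ⟩
    t Fin.zero + sum (t ∘ Fin.suc)               ≈⟨ +-congˡ (sum-init-last (t ∘ Fin.suc)) ⟩
    t Fin.zero + (sum inner + t (fromℕ p))       ≈⟨ +-cong first (+-cong inner≈0 last) ⟩
    y ^ p + (0# + x ^ p)                         ≈⟨ +-congˡ (+-identityˡ (x ^ p)) ⟩
    y ^ p + x ^ p                                ≈⟨ +-comm (y ^ p) (x ^ p) ⟩
    x ^ p + y ^ p                                ∎
    where
    t : Fin (suc p) → Carrier
    t = Binomial.binomialTerm x y p
    inner : Fin p-1 → Carrier
    inner i = t (Fin.suc (inject₁ i))

    multiple·≈0 : ∀ {m} → p ∣ m → ∀ z → m · z ≈ 0#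
    multiple·≈0 (divides q refl) z = begin
      (q ℕ.* p) · z   ≈⟨ ×-congˡ (ℕ.*-comm q p) ⟩
      (p ℕ.* q) · z   ≈⟨ ×-assocˡ z p q ⟨
      p · (q · z)     ≈⟨ p·≈0 (q · z) ⟩
      0#              ∎

    first : t Fin.zero ≈ y ^ p
    first = ≈-trans (×-homo-1 _) (*-identityˡ (y ^ p))

    term-p : ∀ {k} → k ≡ p → (p C k) · (x ^ k * y ^ (p ∸ k)) ≈ x ^ p
    term-p refl rewrite nCn≡1 p | ℕ.n∸n≡0 p = ≈-trans (×-homo-1 _) (*-identityʳ (x ^ p))

    last : t (fromℕ p) ≈ x ^ p
    last = term-p (Fin.toℕ-fromℕ p)

    inner≈0 : sum inner ≈ 0#
    inner≈0 = ≈-trans (sum-cong-≋ vanish) (sum-replicate-zero p-1)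
      where
      vanish : ∀ i → inner i ≈ 0#
      vanish i = multiple·≈0 (prime∣pCk pr (s≤s z≤n) (s≤s (Fin.inject₁ℕ< i))) _

-- Opened only here: the semiring above has its own _+_ and _*_.
open import Data.Nat using (_+_; _*_)

-- Finite sums over lists

𝟙 : {P : Set} → Dec P → ℕ
𝟙 (yes _) = 1
𝟙 (no _)  = 0

module _ {P Q : Set} where

  𝟙-cong : (P → Q) → (Q → P) → (p? : Dec P) (q? : Dec Q) → 𝟙 p? ≡ 𝟙 q?
  𝟙-cong _ _ (yes _) (yes _) = refl
  𝟙-cong f _ (yes p) (no ¬q) = contradiction (f p) ¬q
  𝟙-cong _ g (no ¬p) (yes q) = contradiction (g q) ¬p
  𝟙-cong _ _ (no _)  (no _)  = refl

  𝟙-×-dec : (p? : Dec P) (q? : Dec Q) → 𝟙 (p? ×-dec q?) ≡ 𝟙 p? * 𝟙 q?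
  𝟙-×-dec (yes _) (yes _) = refl
  𝟙-×-dec (yes _) (no _)  = refl
  𝟙-×-dec (no _)  _       = refl

𝟙-yes : {P : Set} → P → (p? : Dec P) → 𝟙 p? ≡ 1
𝟙-yes p (yes _) = refl
𝟙-yes p (no ¬p) = contradiction p ¬p

𝟙-pos : {P : Set} (p? : Dec P) → 0 < 𝟙 p? → P
𝟙-pos (yes p) _ = p

∑ : {A : Set} → List A → (A → ℕ) → ℕ
∑ []       f = 0
∑ (x ∷ xs) f = f x + ∑ xs f

syntax ∑ xs (λ x → e) = ∑[ x ∈ xs ] e

module _ {A : Set} where

  ∑-cong : (xs : List A) {f g : A → ℕ} → (∀ x → f x ≡ g x) → ∑ xs f ≡ ∑ xs g
  ∑-cong []       f≗g = refl
  ∑-cong (x ∷ xs) f≗g = cong₂ _+_ (f≗g x) (∑-cong xs f≗g)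

  ∑-++ : (xs ys : List A) (f : A → ℕ) → ∑ (xs ++ ys) f ≡ ∑ xs f + ∑ ys f
  ∑-++ []       ys f = refl
  ∑-++ (x ∷ xs) ys f = trans (cong (_+_ (f x)) (∑-++ xs ys f)) (sym (ℕ.+-assoc (f x) _ _))

  ∑-+ : (xs : List A) (f g : A → ℕ) → ∑[ x ∈ xs ] (f x + g x) ≡ ∑ xs f + ∑ xs g
  ∑-+ []       f g = refl
  ∑-+ (x ∷ xs) f g = trans (cong (_+_ (f x + g x)) (∑-+ xs f g)) (+-interchange (f x) (g x) _ _)

  ∑-const : (xs : List A) (c : ℕ) → ∑[ x ∈ xs ] c ≡ length xs * c
  ∑-const []       c = refl
  ∑-const (x ∷ xs) c = cong (_+_ c) (∑-const xs c)

  ∑-1 : (xs : List A) → ∑[ x ∈ xs ] 1 ≡ length xs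
  ∑-1 xs = trans (∑-const xs 1) (ℕ.*-identityʳ (length xs))

  ∑-*ˡ : (xs : List A) (c : ℕ) (f : A → ℕ) → ∑[ x ∈ xs ] (c * f x) ≡ c * ∑ xs f
  ∑-*ˡ []       c f = sym (ℕ.*-zeroʳ c)
  ∑-*ˡ (x ∷ xs) c f = trans (cong (_+_ (c * f x)) (∑-*ˡ xs c f)) (sym (ℕ.*-distribˡ-+ c (f x) _))

  ∑-filter : {P : A → Set} (P? : ∀ x → Dec (P x)) (xs : List A) (f : A → ℕ) →
             ∑ (filter P? xs) f ≡ ∑[ x ∈ xs ] (𝟙 (P? x) * f x)
  ∑-filter P? []       f = refl
  ∑-filter P? (x ∷ xs) f with P? x
  ... | yes _ = cong₂ _+_ (sym (ℕ.+-identityʳ (f x))) (∑-filter P? xs f)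
  ... | no _  = ∑-filter P? xs f

  length-filter≡∑𝟙 : {P : A → Set} (P? : ∀ x → Dec (P x)) (xs : List A) →
                     length (filter P? xs) ≡ ∑[ x ∈ xs ] 𝟙 (P? x)
  length-filter≡∑𝟙 P? xs = begin
    length (filter P? xs)              ≡⟨ ∑-1 (filter P? xs) ⟨
    ∑[ x ∈ filter P? xs ] 1            ≡⟨ ∑-filter P? xs (λ _ → 1) ⟩
    ∑[ x ∈ xs ] (𝟙 (P? x) * 1)         ≡⟨ ∑-cong xs (λ x → ℕ.*-identityʳ (𝟙 (P? x))) ⟩
    ∑[ x ∈ xs ] 𝟙 (P? x)               ∎
    where open ≡-Reasoning

  ∑-≥ : (xs : List A) (f : A → ℕ) {x : A} → x ∈ xs → f x ≤ ∑ xs f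
  ∑-≥ (y ∷ xs) f (here refl) = ℕ.m≤m+n (f y) _
  ∑-≥ (y ∷ xs) f (there x∈xs) = ℕ.≤-trans (∑-≥ xs f x∈xs) (ℕ.m≤n+m _ (f y))

  ∑-pos : (xs : List A) (f : A → ℕ) → 0 < ∑ xs f → ∃ λ x → x ∈ xs × 0 < f x
  ∑-pos (x ∷ xs) f pos with f x in fx≡
  ... | suc _ = x , here refl , subst (0 <_) (sym fx≡) (s≤s z≤n)
  ... | zero  = let y , y∈xs , fy>0 = ∑-pos xs f pos in y , there y∈xs , fy>0

  length≤∑ : (xs : List A) (f : A → ℕ) → (∀ {x} → x ∈ xs → 1 ≤ f x) → length xs ≤ ∑ xs f
  length≤∑ []       f pos = z≤n
  length≤∑ (x ∷ xs) f pos = ℕ.+-mono-≤ (pos (here refl)) (length≤∑ xs f (pos ∘ there))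

  ∑≤length⇒all-1 : (xs : List A) (f : A → ℕ) → (∀ {x} → x ∈ xs → 1 ≤ f x) →
                    ∑ xs f ≤ length xs → ∀ {x} → x ∈ xs → f x ≡ 1
  ∑≤length⇒all-1 (y ∷ ys) f pos tot (here refl) = ℕ.≤-antisym fy≤1 (pos (here refl))
    where
    fy≤1 : f y ≤ 1
    fy≤1 = ℕ.+-cancelʳ-≤ (length ys) (f y) 1
             (ℕ.≤-trans (ℕ.+-monoʳ-≤ (f y) (length≤∑ ys f (pos ∘ there))) tot)
  ∑≤length⇒all-1 (y ∷ ys) f pos tot (there x∈ys) =
    ∑≤length⇒all-1 ys f (pos ∘ there) tail≤ x∈ys
    where
    tail≤ : ∑ ys f ≤ length ys
    tail≤ = ℕ.+-cancelˡ-≤ 1 (∑ ys f) (length ys)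
              (ℕ.≤-trans (ℕ.+-monoˡ-≤ (∑ ys f) (pos (here refl))) tot)

module _ {A B : Set} where

  ∑-map : (g : A → B) (xs : List A) (f : B → ℕ) → ∑ (map g xs) f ≡ ∑ xs (f ∘ g)
  ∑-map g []       f = refl
  ∑-map g (x ∷ xs) f = cong (_+_ (f (g x))) (∑-map g xs f)

  ∑-concatMap : (g : A → List B) (xs : List A) (f : B → ℕ) →
                ∑ (concatMap g xs) f ≡ ∑[ x ∈ xs ] ∑ (g x) f
  ∑-concatMap g []       f = refl
  ∑-concatMap g (x ∷ xs) f =
    trans (∑-++ (g x) (concatMap g xs) f) (cong (_+_ (∑ (g x) f)) (∑-concatMap g xs f))

  ∑-comm : (xs : List A) (ys : List B) (f : A → B → ℕ) →
           ∑[ x ∈ xs ] ∑[ y ∈ ys ] f x y ≡ ∑[ y ∈ ys ] ∑[ x ∈ xs ] f x y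
  ∑-comm []       ys f = sym (trans (∑-const ys 0) (ℕ.*-zeroʳ (length ys)))
  ∑-comm (x ∷ xs) ys f =
    trans (cong (_+_ (∑ ys (f x))) (∑-comm xs ys f)) (sym (∑-+ ys (f x) _))

module _ {A B C : Set} where

  ∑-cartesianProductWith : (g : A → B → C) (xs : List A) (ys : List B) (f : C → ℕ) →
    ∑ (cartesianProductWith g xs ys) f ≡ ∑[ x ∈ xs ] ∑[ y ∈ ys ] f (g x y)
  ∑-cartesianProductWith g []       ys f = refl
  ∑-cartesianProductWith g (x ∷ xs) ys f = begin
    ∑ (map (g x) ys ++ cartesianProductWith g xs ys) f
      ≡⟨ ∑-++ (map (g x) ys) _ f ⟩
    ∑ (map (g x) ys) f + ∑ (cartesianProductWith g xs ys) f
      ≡⟨ cong₂ _+_ (∑-map (g x) ys f) (∑-cartesianProductWith g xs ys f) ⟩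
    ∑[ y ∈ ys ] f (g x y) + ∑[ x ∈ xs ] ∑[ y ∈ ys ] f (g x y) ∎
    where open ≡-Reasoning

  length-cartesianProductWith : (g : A → B → C) (xs : List A) (ys : List B) →
    length (cartesianProductWith g xs ys) ≡ length xs * length ys
  length-cartesianProductWith g xs ys = begin
    length (cartesianProductWith g xs ys)        ≡⟨ ∑-1 (cartesianProductWith g xs ys) ⟨
    ∑[ z ∈ cartesianProductWith g xs ys ] 1      ≡⟨ ∑-cartesianProductWith g xs ys (λ _ → 1) ⟩
    ∑[ x ∈ xs ] ∑[ y ∈ ys ] 1                    ≡⟨ ∑-cong xs (λ _ → ∑-1 ys) ⟩
    ∑[ x ∈ xs ] length ys                        ≡⟨ ∑-const xs (length ys) ⟩
    length xs * length ys                        ∎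
    where open ≡-Reasoning

∑-allFin-suc : ∀ m (f : Fin (suc m) → ℕ) → ∑ (allFin (suc m)) f ≡ f Fin.zero + ∑ (allFin m) (f ∘ Fin.suc)
∑-allFin-suc m f = cong (_+_ (f Fin.zero))
  (trans (cong (λ xs → ∑ xs f) (sym (List.map-tabulate (λ i → i) Fin.suc))) (∑-map Fin.suc (allFin m) f))

∑-allFin-𝟙≟ : ∀ {m} (i : Fin m) → ∑[ j ∈ allFin m ] 𝟙 (i Fin.≟ j) ≡ 1
∑-allFin-𝟙≟ {suc m} Fin.zero = begin
  ∑[ j ∈ allFin (suc m) ] 𝟙 (Fin.zero Fin.≟ j)  ≡⟨ ∑-allFin-suc m (λ j → 𝟙 (Fin.zero Fin.≟ j)) ⟩
  1 + ∑[ j ∈ allFin m ] 0                       ≡⟨ cong suc (∑-const (allFin m) 0) ⟩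
  1 + length (allFin m) * 0                     ≡⟨ cong suc (ℕ.*-zeroʳ (length (allFin m))) ⟩
  1                                             ∎
  where open ≡-Reasoning
∑-allFin-𝟙≟ {suc m} (Fin.suc i) = begin
  ∑[ j ∈ allFin (suc m) ] 𝟙 (Fin.suc i Fin.≟ j)
    ≡⟨ ∑-allFin-suc m (λ j → 𝟙 (Fin.suc i Fin.≟ j)) ⟩
  ∑[ j ∈ allFin m ] 𝟙 (Fin.suc i Fin.≟ Fin.suc j)
    ≡⟨ ∑-cong (allFin m) (λ j → 𝟙-cong Fin.suc-injective (cong Fin.suc) _ _) ⟩
  ∑[ j ∈ allFin m ] 𝟙 (i Fin.≟ j)
    ≡⟨ ∑-allFin-𝟙≟ i ⟩
  1 ∎
  where open ≡-Reasoning

-- Congruence modulo n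

∣∧<⇒≡0 : ∀ {n d} → n ∣ d → d < n → d ≡ 0
∣∧<⇒≡0 {d = zero}  _   _   = refl
∣∧<⇒≡0 {d = suc _} n∣d d<n = contradiction n∣d (>⇒∤ d<n)

module _ {n : ℕ} where

  ≡[]⇒∣ : ∀ {x y} → x ≡[ n ] y → + n ℤ.∣ x - y
  ≡[]⇒∣ = ∣ᵤ⇒∣

  ∣⇒≡[] : ∀ {x y} → + n ℤ.∣ x - y → x ≡[ n ] y
  ∣⇒≡[] = ∣⇒∣ᵤ

  ≡[]-reflexive : ∀ {x y} → x ≡ y → x ≡[ n ] y
  ≡[]-reflexive {x} refl = subst (n ∣_) (sym (cong ∣_∣ (ℤ.+-inverseʳ x))) (n ∣0)

  ≡[]-sym : ∀ {x y} → x ≡[ n ] y → y ≡[ n ] x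
  ≡[]-sym {x} {y} = subst (n ∣_) (ℤ.∣i-j∣≡∣j-i∣ x y)

  ≡[]-trans : ∀ {x y z} → x ≡[ n ] y → y ≡[ n ] z → x ≡[ n ] z
  ≡[]-trans {x} {y} {z} x≡y y≡z =
    ∣⇒≡[] {x} {z} (subst (+ n ℤ.∣_) (telescope x y z)
      (∣m∣n⇒∣m+n (≡[]⇒∣ {x} {y} x≡y) (≡[]⇒∣ {y} {z} y≡z)))
    where
    telescope : ∀ x y z → (x - y) +ℤ (y - z) ≡ x - z
    telescope = solve-∀

  ≡[]-+ʳ : ∀ {x y} w → x ≡[ n ] y → (x +ℤ w) ≡[ n ] (y +ℤ w)
  ≡[]-+ʳ {x} {y} w = subst (λ d → n ∣ ∣ d ∣) (cancel x y w)
    where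
    cancel : ∀ x y w → x - y ≡ (x +ℤ w) - (y +ℤ w)
    cancel = solve-∀

  toℕ-≡[]-injective : ∀ {i j : Fin n} → (+ toℕ i) ≡[ n ] (+ toℕ j) → i ≡ j
  toℕ-≡[]-injective {i} {j} i≡j =
    Fin.toℕ-injective (ℤ.+-injective (ℤ.i-j≡0⇒i≡j _ _ (ℤ.∣i∣≡0⇒i≡0 d≡0)))
    where
    d<n : ∣ + toℕ i - + toℕ j ∣ < n
    d<n = ℕ.≤-<-trans
      (subst (ℕ._≤ toℕ i ℕ.⊔ toℕ j) (sym (cong ∣_∣ (ℤ.[+m]-[+n]≡m⊖n (toℕ i) (toℕ j))))
             (ℤ.∣m⊝n∣≤m⊔n (toℕ i) (toℕ j)))
      (ℕ.⊔-pres-<m (Fin.toℕ<n i) (Fin.toℕ<n j))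
    d≡0 : ∣ + toℕ i - + toℕ j ∣ ≡ 0
    d≡0 = ∣∧<⇒≡0 {n} {∣ + toℕ i - + toℕ j ∣} i≡j d<n

  module _ .{{_ : NonZero n}} where

    residue : ℤ → Fin n
    residue x = fromℕ< (n%ℕd<d x n)

    ≡[]-residue : ∀ x → x ≡[ n ] (+ toℕ (residue x))
    ≡[]-residue x = ∣⇒≡[] {x} (ℤ.divides (x /ℕ n) x-r≡q*n)
      where
      r≡x%n : toℕ (residue x) ≡ x %ℕ n
      r≡x%n = Fin.toℕ-fromℕ< (n%ℕd<d x n)
      x-r≡q*n : x - + toℕ (residue x) ≡ (x /ℕ n) *ℤ + n
      x-r≡q*n = begin
        x - + toℕ (residue x)
          ≡⟨ cong₂ (λ y r → y - + r) (a≡a%ℕn+[a/ℕn]*n x n) r≡x%n ⟩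
        (+ (x %ℕ n) +ℤ (x /ℕ n) *ℤ + n) - + (x %ℕ n)
          ≡⟨ cancel (+ (x %ℕ n)) ((x /ℕ n) *ℤ + n) ⟩
        (x /ℕ n) *ℤ + n ∎
        where
        open ≡-Reasoning
        cancel : ∀ r y → (r +ℤ y) - r ≡ y
        cancel = solve-∀

≡[]-scale-residue : ∀ d m .{{_ : NonZero m}} a → (+ (d ℕ.* (a %ℕ m))) ≡[ d ℕ.* m ] (+ d *ℤ a)
≡[]-scale-residue d m a =
  ∣⇒≡[] {d ℕ.* m} {+ (d ℕ.* (a %ℕ m))} {+ d *ℤ a} (ℤ.divides (ℤ.- (a /ℕ m)) (begin
  + (d ℕ.* (a %ℕ m)) - + d *ℤ a
    ≡⟨ cong₂ (λ x y → x - + d *ℤ y) (ℤ.pos-* d (a %ℕ m)) (a≡a%ℕn+[a/ℕn]*n a m) ⟩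
  + d *ℤ + (a %ℕ m) - + d *ℤ (+ (a %ℕ m) +ℤ (a /ℕ m) *ℤ + m)
    ≡⟨ expand (+ d) (+ (a %ℕ m)) (a /ℕ m) (+ m) ⟩
  ℤ.- (a /ℕ m) *ℤ (+ d *ℤ + m)
    ≡⟨ cong (ℤ.- (a /ℕ m) *ℤ_) (ℤ.pos-* d m) ⟨
  ℤ.- (a /ℕ m) *ℤ + (d ℕ.* m)      ∎))
  where
  open ≡-Reasoning
  expand : ∀ d s q m → d *ℤ s - d *ℤ (s +ℤ q *ℤ m) ≡ ℤ.- q *ℤ (d *ℤ m)
  expand = solve-∀

infixl 6 _⊕_

_⊕_ : List ℤ → List ℤ → List ℤ
_⊕_ = cartesianProductWith _+ℤ_

∑-⊕ : ∀ A B (f : ℤ → ℕ) → ∑ (A ⊕ B) f ≡ ∑[ a ∈ A ] ∑[ b ∈ B ] f (a +ℤ b)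
∑-⊕ = ∑-cartesianProductWith _+ℤ_

length-⊕ : ∀ A B → length (A ⊕ B) ≡ length A * length B
length-⊕ = length-cartesianProductWith _+ℤ_

scale : ℕ → List ℤ → List ℤ
scale d = map (+ d *ℤ_)

length-scale : ∀ d A → length (scale d A) ≡ length A
length-scale d A = List.length-map (+ d *ℤ_) A

length-scaledRange : ∀ d m → length (scaledRange d m) ≡ m
length-scaledRange d m = trans (List.length-map _ (upTo m)) (List.length-upTo m)

scale-1 : ∀ A → scale 1 A ≡ A
scale-1 A = trans (List.map-cong ℤ.*-identityˡ A) (List.map-id A)

scale-* : ∀ d e A → scale d (scale e A) ≡ scale (d * e) A
scale-* d e A = trans (sym (List.map-∘ A))
  (List.map-cong (λ a → trans (sym (ℤ.*-assoc (+ d) (+ e) a)) (cong (_*ℤ a) (sym (ℤ.pos-* d e)))) A)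

module Counting (n : ℕ) where

  δ : ℤ → ℤ → ℕ
  δ a c = 𝟙 (a ≡[ n ]? c)

  count : List ℤ → ℤ → ℕ
  count A c = ∑[ a ∈ A ] δ a c

  count-⊕ : ∀ A B c → count (A ⊕ B) c ≡ ∑[ a ∈ A ] count B (c - a)
  count-⊕ A B c =
    trans (∑-⊕ A B _) (∑-cong A λ a → ∑-cong B λ b → cong (λ d → 𝟙 (n ∣? ∣ d ∣)) (shift a b c))
    where
    shift : ∀ a b c → (a +ℤ b) - c ≡ b - (c - a)
    shift = solve-∀

  count-cong : ∀ A {c c'} → c ≡[ n ] c' → count A c ≡ count A c'
  count-cong A {c} {c'} c≡c' = ∑-cong A λ a →
    𝟙-cong (λ a≡c → ≡[]-trans {n} {a} {c} a≡c c≡c')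
           (λ a≡c' → ≡[]-trans {n} {a} {c'} a≡c' (≡[]-sym {n} {c} c≡c')) _ _

  δ-congˡ : ∀ {a a'} c → a ≡[ n ] a' → δ a c ≡ δ a' c
  δ-congˡ {a} {a'} c a≡a' =
    𝟙-cong (≡[]-trans {n} {a'} {a} (≡[]-sym {n} {a} a≡a')) (≡[]-trans {n} {a} {a'} a≡a') _ _

  count-pos⁺ : ∀ {A a c} → a ∈ A → a ≡[ n ] c → 0 < count A c
  count-pos⁺ {A} {a} {c} a∈A a≡c =
    ℕ.<-≤-trans (ℕ.≤-reflexive (sym (𝟙-yes a≡c (a ≡[ n ]? c)))) (∑-≥ A (λ x → δ x c) a∈A)

  count-pos⁻ : ∀ A c → 0 < count A c → ∃ λ a → a ∈ A × a ≡[ n ] c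
  count-pos⁻ A c pos =
    let a , a∈A , δ>0 = ∑-pos A (λ x → δ x c) pos in a , a∈A , 𝟙-pos (a ≡[ n ]? c) δ>0

  Tiles : List ℤ → Set
  Tiles A = ∀ (i : Fin n) → count A (+ toℕ i) ≡ 1

  module _ .{{_ : NonZero n}} where

    ∑-residues-δ : ∀ a → ∑[ j ∈ allFin n ] δ a (+ toℕ j) ≡ 1
    ∑-residues-δ a = trans (∑-cong (allFin n) δ≡) (∑-allFin-𝟙≟ (residue a))
      where
      δ≡ : ∀ j → δ a (+ toℕ j) ≡ 𝟙 (residue a Fin.≟ j)
      δ≡ j = trans (δ-congˡ {a} {+ toℕ (residue a)} (+ toℕ j) (≡[]-residue a))
                   (𝟙-cong toℕ-≡[]-injective (λ { refl → ≡[]-reflexive {n} {+ toℕ j} refl }) _ _)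

    ∑-residues-count : ∀ A → ∑[ j ∈ allFin n ] count A (+ toℕ j) ≡ length A
    ∑-residues-count A = begin
      ∑[ j ∈ allFin n ] ∑[ a ∈ A ] δ a (+ toℕ j) ≡⟨ ∑-comm (allFin n) A _ ⟩
      ∑[ a ∈ A ] ∑[ j ∈ allFin n ] δ a (+ toℕ j) ≡⟨ ∑-cong A ∑-residues-δ ⟩
      ∑[ a ∈ A ] 1                               ≡⟨ ∑-1 A ⟩
      length A                                   ∎
      where open ≡-Reasoning

    Tiles⇒length≡n : ∀ A → Tiles A → length A ≡ n
    Tiles⇒length≡n A tiles = begin
      length A                              ≡⟨ ∑-residues-count A ⟨
      ∑[ j ∈ allFin n ] count A (+ toℕ j)   ≡⟨ ∑-cong (allFin n) tiles ⟩
      ∑[ j ∈ allFin n ] 1                   ≡⟨ ∑-1 (allFin n) ⟩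
      length (allFin n)                     ≡⟨ List.length-tabulate (λ i → i) ⟩
      n                                     ∎
      where open ≡-Reasoning

    cover⇒Tiles : ∀ A → (∀ (i : Fin n) → 0 < count A (+ toℕ i)) → length A ≡ n → Tiles A
    cover⇒Tiles A covers length≡n i =
      ∑≤length⇒all-1 (allFin n) (λ j → count A (+ toℕ j)) (λ {j} _ → covers j) total≤ (∈.∈-allFin i)
      where
      total≤ : ∑[ j ∈ allFin n ] count A (+ toℕ j) ≤ length (allFin n)
      total≤ = ℕ.≤-reflexive
        (trans (∑-residues-count A) (trans length≡n (sym (List.length-tabulate (λ i → i)))))

    Tiles⇒count≡1 : ∀ A → Tiles A → ∀ c → count A c ≡ 1
    Tiles⇒count≡1 A tiles c = trans (count-cong A {c} (≡[]-residue c)) (tiles (residue c))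

    count-⊕-Tiles : ∀ B T → Tiles T → ∀ c → count (B ⊕ T) c ≡ length B
    count-⊕-Tiles B T tiles c =
      trans (count-⊕ B T c) (trans (∑-cong B λ b → Tiles⇒count≡1 T tiles (c - b)) (∑-1 B))

-- The multiset semiring modulo a prime

infix 4 _∼_

_∼_ : {X : Set} → List X → List X → Set
A ∼ B = ∀ f → ∑ A f ≡ ∑ B f

∼-reflexive : {X : Set} {A B : List X} → A ≡ B → A ∼ B
∼-reflexive refl f = refl

++-comm-∼ : {X : Set} (A B : List X) → A ++ B ∼ B ++ A
++-comm-∼ A B f = trans (∑-++ A B f) (trans (ℕ.+-comm (∑ A f) _) (sym (∑-++ B A f)))

⊕-assoc-∼ : ∀ A B D → (A ⊕ B) ⊕ D ∼ A ⊕ (B ⊕ D)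
⊕-assoc-∼ A B D f = begin
  ∑ ((A ⊕ B) ⊕ D) f                                  ≡⟨ ∑-⊕ (A ⊕ B) D f ⟩
  ∑[ x ∈ A ⊕ B ] ∑[ c ∈ D ] f (x +ℤ c)               ≡⟨ ∑-⊕ A B _ ⟩
  ∑[ a ∈ A ] ∑[ b ∈ B ] ∑[ c ∈ D ] f (a +ℤ b +ℤ c)
    ≡⟨ ∑-cong A (λ a → ∑-cong B λ b → ∑-cong D λ c → cong f (ℤ.+-assoc a b c)) ⟩
  ∑[ a ∈ A ] ∑[ b ∈ B ] ∑[ c ∈ D ] f (a +ℤ (b +ℤ c)) ≡⟨ ∑-cong A (λ a → ∑-⊕ B D _) ⟨
  ∑[ a ∈ A ] ∑[ y ∈ B ⊕ D ] f (a +ℤ y)               ≡⟨ ∑-⊕ A (B ⊕ D) f ⟨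
  ∑ (A ⊕ (B ⊕ D)) f                                  ∎
  where open ≡-Reasoning

⊕-comm-∼ : ∀ A B → A ⊕ B ∼ B ⊕ A
⊕-comm-∼ A B f = begin
  ∑ (A ⊕ B) f                         ≡⟨ ∑-⊕ A B f ⟩
  ∑[ a ∈ A ] ∑[ b ∈ B ] f (a +ℤ b)    ≡⟨ ∑-comm A B _ ⟩
  ∑[ b ∈ B ] ∑[ a ∈ A ] f (a +ℤ b)    ≡⟨ ∑-cong B (λ b → ∑-cong A λ a → cong f (ℤ.+-comm a b)) ⟩
  ∑[ b ∈ B ] ∑[ a ∈ A ] f (b +ℤ a)    ≡⟨ ∑-⊕ B A f ⟨
  ∑ (B ⊕ A) f                         ∎
  where open ≡-Reasoning

⊕-congʳ-∼ : ∀ A B D → A ∼ B → A ⊕ D ∼ B ⊕ D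
⊕-congʳ-∼ A B D A∼B f = trans (∑-⊕ A D f) (trans (A∼B _) (sym (∑-⊕ B D f)))

⊕-identityˡ-∼ : ∀ A → [ + 0 ] ⊕ A ∼ A
⊕-identityˡ-∼ A f =
  trans (∑-⊕ [ + 0 ] A f) (trans (ℕ.+-identityʳ _) (∑-cong A λ a → cong f (ℤ.+-identityˡ a)))

⊕-identityʳ-∼ : ∀ A → A ⊕ [ + 0 ] ∼ A
⊕-identityʳ-∼ A f = trans (⊕-comm-∼ A [ + 0 ] f) (⊕-identityˡ-∼ A f)

⊕-distribˡ-∼ : ∀ A B D → A ⊕ (B ++ D) ∼ (A ⊕ B) ++ (A ⊕ D)
⊕-distribˡ-∼ A B D f = begin
  ∑ (A ⊕ (B ++ D)) f                      ≡⟨ ⊕-comm-∼ A (B ++ D) f ⟩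
  ∑ ((B ++ D) ⊕ A) f                      ≡⟨ cong (λ E → ∑ E f) (List.cartesianProductWith-distribʳ-++ _+ℤ_ B D A) ⟩
  ∑ ((B ⊕ A) ++ (D ⊕ A)) f                ≡⟨ ∑-++ (B ⊕ A) (D ⊕ A) f ⟩
  ∑ (B ⊕ A) f + ∑ (D ⊕ A) f               ≡⟨ cong₂ _+_ (⊕-comm-∼ B A f) (⊕-comm-∼ D A f) ⟩
  ∑ (A ⊕ B) f + ∑ (A ⊕ D) f               ≡⟨ ∑-++ (A ⊕ B) (A ⊕ D) f ⟨
  ∑ ((A ⊕ B) ++ (A ⊕ D)) f                ∎
  where open ≡-Reasoning

module MultisetSemiring (n r : ℕ) .{{_ : NonZero r}} where
  open Counting n

  infix 4 _≈_

  record _≈_ (A B : List ℤ) : Set where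
    constructor mk≈
    field count-mod : ∀ c → count A c % r ≡ count B c % r
  open _≈_

  ∼⇒≈ : ∀ {A B} → A ∼ B → A ≈ B
  ∼⇒≈ A∼B = mk≈ λ c → cong (_% r) (A∼B (λ a → δ a c))

  +-cong-mod : ∀ {a a' b b'} → a % r ≡ a' % r → b % r ≡ b' % r → (a + b) % r ≡ (a' + b') % r
  +-cong-mod {a} {a'} {b} {b'} a≡a' b≡b' = begin
    (a + b) % r                ≡⟨ ℕ.%-distribˡ-+ a b r ⟩
    (a % r + b % r) % r        ≡⟨ cong₂ (λ x y → (x + y) % r) a≡a' b≡b' ⟩
    (a' % r + b' % r) % r      ≡⟨ ℕ.%-distribˡ-+ a' b' r ⟨
    (a' + b') % r              ∎
    where open ≡-Reasoning

  ∑-cong-mod : {X : Set} (xs : List X) {f g : X → ℕ} →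
               (∀ x → f x % r ≡ g x % r) → ∑ xs f % r ≡ ∑ xs g % r
  ∑-cong-mod []       f≡g = refl
  ∑-cong-mod (x ∷ xs) f≡g = +-cong-mod (f≡g x) (∑-cong-mod xs f≡g)

  ++-cong : ∀ {A A' B B'} → A ≈ A' → B ≈ B' → A ++ B ≈ A' ++ B'
  ++-cong {A} {A'} {B} {B'} A≈A' B≈B' = mk≈ λ c → begin
    count (A ++ B) c % r              ≡⟨ cong (_% r) (∑-++ A B _) ⟩
    (count A c + count B c) % r       ≡⟨ +-cong-mod (count-mod A≈A' c) (count-mod B≈B' c) ⟩
    (count A' c + count B' c) % r     ≡⟨ cong (_% r) (∑-++ A' B' _) ⟨
    count (A' ++ B') c % r            ∎
    where open ≡-Reasoning

  ⊕-cong : ∀ {A A' B B'} → A ≈ A' → B ≈ B' → A ⊕ B ≈ A' ⊕ B'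
  ⊕-cong {A} {A'} {B} {B'} A≈A' B≈B' = mk≈ λ c → begin
    count (A ⊕ B) c % r                   ≡⟨ cong (_% r) (count-⊕ A B c) ⟩
    (∑[ a ∈ A ] count B (c - a)) % r      ≡⟨ ∑-cong-mod A (λ a → count-mod B≈B' (c - a)) ⟩
    (∑[ a ∈ A ] count B' (c - a)) % r     ≡⟨ cong (_% r) (trans (⊕-comm-∼ B' A _) (count-⊕ A B' c)) ⟨
    count (B' ⊕ A) c % r                  ≡⟨ cong (_% r) (count-⊕ B' A c) ⟩
    (∑[ b ∈ B' ] count A (c - b)) % r     ≡⟨ ∑-cong-mod B' (λ b → count-mod A≈A' (c - b)) ⟩
    (∑[ b ∈ B' ] count A' (c - b)) % r    ≡⟨ cong (_% r) (trans (⊕-comm-∼ A' B' _) (count-⊕ B' A' c)) ⟨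
    count (A' ⊕ B') c % r                 ∎
    where open ≡-Reasoning

  isCommutativeSemiring : IsCommutativeSemiring _≈_ _++_ _⊕_ [] [ + 0 ]
  isCommutativeSemiring = record
    { isSemiring = record
      { isSemiringWithoutAnnihilatingZero = record
        { +-isCommutativeMonoid = record
          { isMonoid = record
            { isSemigroup = record
              { isMagma = record
                { isEquivalence = record
                  { refl  = mk≈ λ _ → refl
                  ; sym   = λ A≈B → mk≈ λ c → sym (count-mod A≈B c)
                  ; trans = λ A≈B B≈C → mk≈ λ c → trans (count-mod A≈B c) (count-mod B≈C c)
                  }
                ; ∙-cong = ++-cong
                }
              ; assoc = λ A B D → ∼⇒≈ (∼-reflexive (List.++-assoc A B D))
              }
            ; identity = (λ A → mk≈ λ _ → refl) , (λ A → ∼⇒≈ (∼-reflexive (List.++-identityʳ A)))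
            }
          ; comm = λ A B → ∼⇒≈ (++-comm-∼ A B)
          }
        ; *-cong = ⊕-cong
        ; *-assoc = λ A B D → ∼⇒≈ (⊕-assoc-∼ A B D)
        ; *-identity = (λ A → ∼⇒≈ (⊕-identityˡ-∼ A)) , (λ A → ∼⇒≈ (⊕-identityʳ-∼ A))
        ; distrib = (λ A B D → ∼⇒≈ (⊕-distribˡ-∼ A B D))
                  , (λ A B D → ∼⇒≈ (∼-reflexive (List.cartesianProductWith-distribʳ-++ _+ℤ_ B D A)))
        }
      ; zero = (λ A → mk≈ λ _ → refl)
             , (λ A → ∼⇒≈ (∼-reflexive (List.cartesianProductWith-zeroʳ _+ℤ_ A)))
      }
    ; *-comm = λ A B → ∼⇒≈ (⊕-comm-∼ A B)
    }

  multisetSemiring : CommutativeSemiring _ _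
  multisetSemiring = record { isCommutativeSemiring = isCommutativeSemiring }

  open CommutativeSemiring multisetSemiring using (semiring; setoid)
  open import Algebra.Properties.Semiring.Exp semiring public using (_^_)
  open import Algebra.Properties.Semiring.Exp semiring using (^-congʳ)
  open import Algebra.Properties.Semiring.Mult semiring using () renaming (_×_ to _·_)

  length-^ : ∀ A k → length (A ^ k) ≡ length A ℕ.^ k
  length-^ A zero    = refl
  length-^ A (suc k) = trans (length-⊕ A (A ^ k)) (cong (length A *_) (length-^ A k))

  count-· : ∀ m A c → count (m · A) c ≡ m * count A c
  count-· zero    A c = refl
  count-· (suc m) A c = trans (∑-++ A (m · A) _) (cong (_+_ (count A c)) (count-· m A c))

  r·≈[] : ∀ A → r · A ≈ []
  r·≈[] A = mk≈ λ c → begin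
    count (r · A) c % r     ≡⟨ cong (_% r) (count-· r A c) ⟩
    (r * count A c) % r     ≡⟨ n∣m⇒m%n≡0 _ r (m∣m*n (count A c)) ⟩
    0                       ≡⟨ n∣m⇒m%n≡0 0 r (r ∣0) ⟨
    0 % r                   ∎
    where open ≡-Reasoning

  [a]^k∼[k*a] : ∀ k a → [ a ] ^ k ∼ [ + k *ℤ a ]
  [a]^k∼[k*a] zero    a f = cong (λ x → f x + 0) (sym (ℤ.*-zeroˡ a))
  [a]^k∼[k*a] (suc k) a f = begin
    ∑ ([ a ] ⊕ [ a ] ^ k) f            ≡⟨ ∑-⊕ [ a ] ([ a ] ^ k) f ⟩
    ∑[ b ∈ [ a ] ^ k ] f (a +ℤ b) + 0   ≡⟨ cong (_+ 0) ([a]^k∼[k*a] k a (λ b → f (a +ℤ b))) ⟩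
    f (a +ℤ + k *ℤ a) + 0 + 0            ≡⟨ cong (λ x → f x + 0 + 0) (ℤ.suc-* (+ k) a) ⟨
    f (+ suc k *ℤ a) + 0 + 0             ≡⟨ ℕ.+-identityʳ _ ⟩
    f (+ suc k *ℤ a) + 0                 ∎
    where open ≡-Reasoning

  frobenius : Prime r → ∀ A → A ^ r ≈ scale r A
  frobenius r-prime []      = ^-congʳ [] (sym (ℕ.suc-pred r))
  frobenius r-prime (a ∷ A) = begin
    ([ a ] ++ A) ^ r          ≈⟨ [x+y]^p≈x^p+y^p multisetSemiring r-prime r·≈[] [ a ] A ⟩
    [ a ] ^ r ++ A ^ r        ≈⟨ ++-cong (∼⇒≈ ([a]^k∼[k*a] r a)) (frobenius r-prime A) ⟩
    scale r (a ∷ A)           ∎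
    where open import Relation.Binary.Reasoning.Setoid setoid

-- Tijdeman's multiplier theorem

module Tilings (n : ℕ) .{{n≢0 : NonZero n}} where
  open Counting n

  nonZero-factorˡ : ∀ d m → n ≡ d * m → NonZero d
  nonZero-factorˡ d m n≡dm = ℕ.m*n≢0⇒m≢0 d {{subst NonZero n≡dm n≢0}}

  nonZero-factorʳ : ∀ d m → n ≡ d * m → NonZero m
  nonZero-factorʳ d m n≡dm = ℕ.m*n≢0⇒n≢0 d {{subst NonZero n≡dm n≢0}}

  tiles-scale-prime : ∀ {r} A K → Prime r → ¬ r ∣ length A → Tiles (A ⊕ K) → Tiles (scale r A ⊕ K)
  tiles-scale-prime {zero} A K r-prime = contradiction refl (ℕ.≢-nonZero⁻¹ 0 {{prime⇒nonZero r-prime}})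
  tiles-scale-prime {r@(suc r-1)} A K r-prime r∤|A| tiles = cover⇒Tiles (scale r A ⊕ K) covers length≡n
    where
    open MultisetSemiring n r

    count-A^r⊕K : ∀ c → count (A ^ r ⊕ K) c ≡ length A ℕ.^ r-1
    count-A^r⊕K c = begin
      count (A ⊕ A ^ r-1 ⊕ K) c
        ≡⟨ ⊕-congʳ-∼ (A ⊕ A ^ r-1) (A ^ r-1 ⊕ A) K (⊕-comm-∼ A (A ^ r-1)) _ ⟩
      count (A ^ r-1 ⊕ A ⊕ K) c         ≡⟨ ⊕-assoc-∼ (A ^ r-1) A K _ ⟩
      count (A ^ r-1 ⊕ (A ⊕ K)) c       ≡⟨ count-⊕-Tiles (A ^ r-1) (A ⊕ K) tiles c ⟩
      length (A ^ r-1)                  ≡⟨ length-^ A r-1 ⟩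
      length A ℕ.^ r-1                  ∎
      where open ≡-Reasoning

    covers : ∀ (i : Fin n) → 0 < count (scale r A ⊕ K) (+ toℕ i)
    covers i = ℕ.n≢0⇒n>0 λ count≡0 →
      r∤|A| (prime∣m^k⇒prime∣m r-prime (length A) r-1 (m%n≡0⇒n∣m _ r (|A|^[r-1]%r≡0 count≡0)))
      where
      c = + toℕ i
      |A|^[r-1]%r≡0 : count (scale r A ⊕ K) c ≡ 0 → length A ℕ.^ r-1 % r ≡ 0
      |A|^[r-1]%r≡0 count≡0 = begin
        length A ℕ.^ r-1 % r              ≡⟨ cong (_% r) (count-A^r⊕K c) ⟨
        count (A ^ r ⊕ K) c % r           ≡⟨ _≈_.count-mod (⊕-cong (frobenius r-prime A) (mk≈ λ _ → refl)) c ⟩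
        count (scale r A ⊕ K) c % r       ≡⟨ cong (_% r) count≡0 ⟩
        0 % r                             ≡⟨⟩
        0                                 ∎
        where open ≡-Reasoning

    length≡n : length (scale r A ⊕ K) ≡ n
    length≡n = begin
      length (scale r A ⊕ K)           ≡⟨ length-⊕ (scale r A) K ⟩
      length (scale r A) * length K    ≡⟨ cong (_* length K) (length-scale r A) ⟩
      length A * length K              ≡⟨ length-⊕ A K ⟨
      length (A ⊕ K)                   ≡⟨ Tiles⇒length≡n (A ⊕ K) tiles ⟩
      n                                ∎
      where open ≡-Reasoning

  tiles-scale-product : ∀ ps → All Prime ps → ∀ A K → Coprime (product ps) (length A) →
                        Tiles (A ⊕ K) → Tiles (scale (product ps) A ⊕ K)
  tiles-scale-product [] [] A K _ tiles = subst (λ B → Tiles (B ⊕ K)) (sym (scale-1 A)) tiles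
  tiles-scale-product (p ∷ ps) (p-prime ∷ ps-prime) A K coprime tiles =
    subst (λ B → Tiles (B ⊕ K)) (scale-* p (product ps) A)
      (tiles-scale-prime (scale (product ps) A) K p-prime p∤|psA|
        (tiles-scale-product ps ps-prime A K coprime-ps tiles))
    where
    coprime-ps : Coprime (product ps) (length A)
    coprime-ps (d∣ps , d∣|A|) = coprime (∣n⇒∣m*n p d∣ps , d∣|A|)
    p∤|psA| : ¬ p ∣ length (scale (product ps) A)
    p∤|psA| p∣|psA| =
      prime≢1 p-prime (coprime (m∣m*n (product ps) , subst (p ∣_) (length-scale (product ps) A) p∣|psA|))

  tiles-scale : ∀ m .{{_ : NonZero m}} A K → Coprime m (length A) → Tiles (A ⊕ K) → Tiles (scale m A ⊕ K)
  tiles-scale m A K coprime tiles =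
    subst (λ k → Tiles (scale k A ⊕ K)) (sym m≡∏ps)
      (tiles-scale-product ps ps-prime A K (subst (λ k → Coprime k (length A)) m≡∏ps coprime) tiles)
    where
    open PrimeFactorisation (factorise m)
      renaming (factors to ps; isFactorisation to m≡∏ps; factorsPrime to ps-prime)

  tiles-scale⇒tiles-scaledRange : ∀ d m .{{_ : NonZero m}} A K → n ≡ d * m → length A ≡ m →
                                   Tiles (scale d A ⊕ K) → Tiles (scaledRange d m ⊕ K)
  tiles-scale⇒tiles-scaledRange d m A K n≡dm |A|≡m tiles =
    cover⇒Tiles (scaledRange d m ⊕ K) covers length≡n
    where
    covers : ∀ (i : Fin n) → 0 < count (scaledRange d m ⊕ K) (+ toℕ i)
    covers i with count-pos⁻ (scale d A ⊕ K) (+ toℕ i) (ℕ.≤-reflexive (sym (tiles i)))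
    ... | x , x∈ , x≡i with ∈.∈-cartesianProductWith⁻ _+ℤ_ (scale d A) K x∈
    ... | _ , k , da∈ , k∈K , refl with ∈.∈-map⁻ (+ d *ℤ_) da∈
    ... | a , a∈A , refl = count-pos⁺ {scaledRange d m ⊕ K} {+ (d * (a %ℕ m)) +ℤ k} {+ toℕ i}
            (∈.∈-cartesianProductWith⁺ _+ℤ_ (∈.∈-map⁺ (λ j → + (d * j)) (∈.∈-upTo⁺ (n%ℕd<d a m))) k∈K)
            (≡[]-trans {n} {+ (d * (a %ℕ m)) +ℤ k} {+ d *ℤ a +ℤ k}
              (≡[]-+ʳ {n} {+ (d * (a %ℕ m))} {+ d *ℤ a} k ds≡da) x≡i)
      where
      ds≡da : (+ (d * (a %ℕ m))) ≡[ n ] (+ d *ℤ a)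
      ds≡da = subst (λ N → (+ (d * (a %ℕ m))) ≡[ N ] (+ d *ℤ a)) (sym n≡dm) (≡[]-scale-residue d m a)

    length≡n : length (scaledRange d m ⊕ K) ≡ n
    length≡n = begin
      length (scaledRange d m ⊕ K)            ≡⟨ length-⊕ (scaledRange d m) K ⟩
      length (scaledRange d m) * length K     ≡⟨ cong (_* length K) (length-scaledRange d m) ⟩
      m * length K                            ≡⟨ cong (_* length K) (trans (length-scale d A) |A|≡m) ⟨
      length (scale d A) * length K           ≡⟨ length-⊕ (scale d A) K ⟨
      length (scale d A ⊕ K)                  ≡⟨ Tiles⇒length≡n (scale d A ⊕ K) tiles ⟩
      n                                       ∎
      where open ≡-Reasoning

  tiles-scaledRange : ∀ d m A K → n ≡ d * m → Coprime d m → length A ≡ m →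
                      Tiles (A ⊕ K) → Tiles (scaledRange d m ⊕ K)
  tiles-scaledRange d m A K n≡dm coprime |A|≡m tiles =
    tiles-scale⇒tiles-scaledRange d m A K n≡dm |A|≡m
      (tiles-scale d A K (subst (Coprime d) (sym |A|≡m) coprime) tiles)
    where
    instance
      d≢0 = nonZero-factorˡ d m n≡dm
      m≢0 = nonZero-factorʳ d m n≡dm

  Tiles-range⊕scaledRange : ∀ p q → n ≡ p * q → Tiles (scaledRange 1 p ⊕ scaledRange p q)
  Tiles-range⊕scaledRange p q n≡pq = cover⇒Tiles (scaledRange 1 p ⊕ scaledRange p q) covers length≡n
    where
    instance
      p≢0 = nonZero-factorˡ p q n≡pq
    covers : ∀ (i : Fin n) → 0 < count (scaledRange 1 p ⊕ scaledRange p q) (+ toℕ i)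
    covers i = count-pos⁺ {scaledRange 1 p ⊕ scaledRange p q} {+ (1 * s) +ℤ + (p * t)} {+ toℕ i}
      (∈.∈-cartesianProductWith⁺ _+ℤ_ (∈.∈-map⁺ (λ j → + (1 * j)) (∈.∈-upTo⁺ s<p))
                                      (∈.∈-map⁺ (λ j → + (p * j)) (∈.∈-upTo⁺ t<q)))
      (≡[]-reflexive {n} {+ (1 * s) +ℤ + (p * t)} s+pt≡i)
      where
      s = toℕ i % p
      t = toℕ i ℕ./ p
      s<p : s < p
      s<p = ℕ.m%n<n (toℕ i) p
      t<q : t < q
      t<q = ℕ.m<n*o⇒m/o<n (subst (toℕ i <_) (trans n≡pq (ℕ.*-comm p q)) (Fin.toℕ<n i))
      s+pt≡i : + (1 * s) +ℤ + (p * t) ≡ + toℕ i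
      s+pt≡i = begin
        + (1 * s) +ℤ + (p * t)    ≡⟨ ℤ.pos-+ (1 * s) (p * t) ⟨
        + (1 * s + p * t)         ≡⟨ cong +_ (cong₂ _+_ (ℕ.*-identityˡ s) (ℕ.*-comm p t)) ⟩
        + (s + t * p)             ≡⟨ cong +_ (ℕ.m≡m%n+[m/n]*n (toℕ i) p) ⟨
        + toℕ i                   ∎
        where open ≡-Reasoning
    length≡n : length (scaledRange 1 p ⊕ scaledRange p q) ≡ n
    length≡n = trans (length-⊕ (scaledRange 1 p) (scaledRange p q))
      (trans (cong₂ _*_ (length-scaledRange 1 p) (length-scaledRange p q)) (sym n≡pq))

-- Bordering as tiling

module Bordering (n : ℕ) where
  open Counting n

  left right : Fin n × Fin n → ℤ
  left  (k , _) = + toℕ k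
  right (_ , l) = + toℕ l

  endsAt : (j : Fin n) (xq : (Fin n × Fin n) × ℤ) →
           Dec ((right (proj₁ xq) +ℤ proj₂ xq) ≡[ n ] (+ toℕ j))
  endsAt j (x , q) = (right x +ℤ q) ≡[ n ]? (+ toℕ j)

  startsAt : (i : Fin n) (px : ℤ × (Fin n × Fin n)) →
             Dec ((proj₁ px +ℤ left (proj₂ px)) ≡[ n ] (+ toℕ i))
  startsAt i (p , x) = (p +ℤ left x) ≡[ n ]? (+ toℕ i)

  -- prefixes X Q j is the multiset W_j: the k of the pairs (a^k b a^l ∈ X, q ∈ Q) with l + q ≡ j.
  prefixes : List (Fin n × Fin n) → List ℤ → Fin n → List ℤ
  prefixes X Q j = map (left ∘ proj₁) (filter (endsAt j) (cartesianProduct X Q))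

  suffixes : List ℤ → List (Fin n × Fin n) → Fin n → List ℤ
  suffixes P X i = map (right ∘ proj₂) (filter (startsAt i) (cartesianProduct P X))

  coeff≡∑ : ∀ P X Q i j → coeff n P X Q i j ≡
            ∑[ p ∈ P ] ∑[ x ∈ X ] ∑[ q ∈ Q ] (δ (p +ℤ left x) (+ toℕ i) * δ (right x +ℤ q) (+ toℕ j))
  coeff≡∑ P X Q i j =
    trans (length-filter≡∑𝟙 D T)
      (trans (∑-concatMap _ P _) (∑-cong P λ p →
        trans (∑-concatMap _ X _) (∑-cong X λ x →
          trans (∑-map _ Q _) (∑-cong Q λ q →
            𝟙-×-dec ((p +ℤ left x) ≡[ n ]? (+ toℕ i)) ((right x +ℤ q) ≡[ n ]? (+ toℕ j))))))
    where
    T : List (ℤ × (Fin n × Fin n) × ℤ)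
    T = concatMap (λ p → concatMap (λ x → map (λ q → (p , x , q)) Q) X) P
    D : (t : ℤ × (Fin n × Fin n) × ℤ) → Dec _
    D (p , x , q) = ((p +ℤ left x) ≡[ n ]? (+ toℕ i)) ×-dec ((right x +ℤ q) ≡[ n ]? (+ toℕ j))

  ∑-prefixes : ∀ X Q j f →
    ∑ (prefixes X Q j) f ≡ ∑[ x ∈ X ] ∑[ q ∈ Q ] (δ (right x +ℤ q) (+ toℕ j) * f (left x))
  ∑-prefixes X Q j f =
    trans (∑-map (left ∘ proj₁) (filter (endsAt j) (cartesianProduct X Q)) f)
      (trans (∑-filter (endsAt j) (cartesianProduct X Q) (f ∘ left ∘ proj₁))
        (∑-cartesianProductWith _,_ X Q _))

  ∑-suffixes : ∀ P X i f →
    ∑ (suffixes P X i) f ≡ ∑[ p ∈ P ] ∑[ x ∈ X ] (δ (p +ℤ left x) (+ toℕ i) * f (right x))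
  ∑-suffixes P X i f =
    trans (∑-map (right ∘ proj₂) (filter (startsAt i) (cartesianProduct P X)) f)
      (trans (∑-filter (startsAt i) (cartesianProduct P X) (f ∘ right ∘ proj₂))
        (∑-cartesianProductWith _,_ P X _))

  coeff≡count-prefixes : ∀ P X Q i j → coeff n P X Q i j ≡ count (P ⊕ prefixes X Q j) (+ toℕ i)
  coeff≡count-prefixes P X Q i j = begin
    coeff n P X Q i j
      ≡⟨ coeff≡∑ P X Q i j ⟩
    ∑[ p ∈ P ] ∑[ x ∈ X ] ∑[ q ∈ Q ] (δ (p +ℤ left x) (+ toℕ i) * δ (right x +ℤ q) (+ toℕ j))
      ≡⟨ ∑-cong P (λ p → ∑-cong X λ x → ∑-cong Q λ q → ℕ.*-comm (δ (p +ℤ left x) (+ toℕ i)) _) ⟩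
    ∑[ p ∈ P ] ∑[ x ∈ X ] ∑[ q ∈ Q ] (δ (right x +ℤ q) (+ toℕ j) * δ (p +ℤ left x) (+ toℕ i))
      ≡⟨ ∑-cong P (λ p → ∑-prefixes X Q j (λ w → δ (p +ℤ w) (+ toℕ i))) ⟨
    ∑[ p ∈ P ] ∑[ w ∈ prefixes X Q j ] δ (p +ℤ w) (+ toℕ i)
      ≡⟨ ∑-⊕ P (prefixes X Q j) _ ⟨
    count (P ⊕ prefixes X Q j) (+ toℕ i) ∎
    where open ≡-Reasoning

  coeff≡count-suffixes : ∀ P X Q i j → coeff n P X Q i j ≡ count (Q ⊕ suffixes P X i) (+ toℕ j)
  coeff≡count-suffixes P X Q i j = begin
    coeff n P X Q i j
      ≡⟨ coeff≡∑ P X Q i j ⟩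
    ∑[ p ∈ P ] ∑[ x ∈ X ] ∑[ q ∈ Q ] (δ (p +ℤ left x) (+ toℕ i) * δ (right x +ℤ q) (+ toℕ j))
      ≡⟨ ∑-cong P (λ p → ∑-comm X Q _) ⟩
    ∑[ p ∈ P ] ∑[ q ∈ Q ] ∑[ x ∈ X ] (δ (p +ℤ left x) (+ toℕ i) * δ (right x +ℤ q) (+ toℕ j))
      ≡⟨ ∑-comm P Q _ ⟩
    ∑[ q ∈ Q ] ∑[ p ∈ P ] ∑[ x ∈ X ] (δ (p +ℤ left x) (+ toℕ i) * δ (right x +ℤ q) (+ toℕ j))
      ≡⟨ ∑-cong Q (λ q → ∑-cong P λ p → ∑-cong X λ x →
           cong (δ (p +ℤ left x) (+ toℕ i) *_) (cong (λ y → δ y (+ toℕ j)) (ℤ.+-comm (right x) q))) ⟩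
    ∑[ q ∈ Q ] ∑[ p ∈ P ] ∑[ x ∈ X ] (δ (p +ℤ left x) (+ toℕ i) * δ (q +ℤ right x) (+ toℕ j))
      ≡⟨ ∑-cong Q (λ q → ∑-suffixes P X i (λ v → δ (q +ℤ v) (+ toℕ j))) ⟨
    ∑[ q ∈ Q ] ∑[ v ∈ suffixes P X i ] δ (q +ℤ v) (+ toℕ j)
      ≡⟨ ∑-⊕ Q (suffixes P X i) _ ⟨
    count (Q ⊕ suffixes P X i) (+ toℕ j) ∎
    where open ≡-Reasoning

  Borders⇔Tiles-⊕prefixes : ∀ P X Q → Borders n P X Q ⇔ (∀ j → Tiles (P ⊕ prefixes X Q j))
  Borders⇔Tiles-⊕prefixes P X Q = mk⇔
    (λ borders j i → trans (sym (coeff≡count-prefixes P X Q i j)) (borders i j))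
    (λ tiles i j → trans (coeff≡count-prefixes P X Q i j) (tiles j i))

  Borders⇔Tiles-⊕suffixes : ∀ P X Q → Borders n P X Q ⇔ (∀ i → Tiles (Q ⊕ suffixes P X i))
  Borders⇔Tiles-⊕suffixes P X Q = mk⇔
    (λ borders i j → trans (sym (coeff≡count-suffixes P X Q i j)) (borders i j))
    (λ tiles i j → trans (coeff≡count-suffixes P X Q i j) (tiles i j))

  Tiles⇒IsFactorization : ∀ P Q → Tiles (P ⊕ Q) → IsFactorization n P Q
  Tiles⇒IsFactorization P Q tiles k = begin
    length (filter sumsTo-k pairs)   ≡⟨ length-filter≡∑𝟙 sumsTo-k pairs ⟩
    ∑[ pq ∈ pairs ] 𝟙 (sumsTo-k pq)  ≡⟨ ∑-concatMap (λ p → map (p ,_) Q) P _ ⟩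
    ∑[ p ∈ P ] ∑ (map (p ,_) Q) _    ≡⟨ ∑-cong P (λ p → ∑-map (p ,_) Q _) ⟩
    ∑[ p ∈ P ] ∑[ q ∈ Q ] δ (p +ℤ q) (+ toℕ k) ≡⟨ ∑-⊕ P Q _ ⟨
    count (P ⊕ Q) (+ toℕ k)          ≡⟨ tiles k ⟩
    1                                ∎
    where
    open ≡-Reasoning
    sumsTo-k : (pq : ℤ × ℤ) → Dec ((proj₁ pq +ℤ proj₂ pq) ≡[ n ] (+ toℕ k))
    sumsTo-k pq = (proj₁ pq +ℤ proj₂ pq) ≡[ n ]? (+ toℕ k)
    pairs : List (ℤ × ℤ)
    pairs = concatMap (λ p → map (λ q → (p , q)) Q) P

  module _ .{{_ : NonZero n}} where

    ∑-length-prefixes : ∀ X Q → ∑[ j ∈ allFin n ] length (prefixes X Q j) ≡ length X * length Q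
    ∑-length-prefixes X Q = begin
      ∑[ j ∈ allFin n ] length (prefixes X Q j)
        ≡⟨ ∑-cong (allFin n) (λ j → trans (sym (∑-1 (prefixes X Q j))) (∑-prefixes X Q j (λ _ → 1))) ⟩
      ∑[ j ∈ allFin n ] ∑[ x ∈ X ] ∑[ q ∈ Q ] (δ (right x +ℤ q) (+ toℕ j) * 1)
        ≡⟨ ∑-comm (allFin n) X _ ⟩
      ∑[ x ∈ X ] ∑[ j ∈ allFin n ] ∑[ q ∈ Q ] (δ (right x +ℤ q) (+ toℕ j) * 1)
        ≡⟨ ∑-cong X (λ x → ∑-comm (allFin n) Q _) ⟩
      ∑[ x ∈ X ] ∑[ q ∈ Q ] ∑[ j ∈ allFin n ] (δ (right x +ℤ q) (+ toℕ j) * 1)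
        ≡⟨ ∑-cong X (λ x → ∑-cong Q λ q →
             trans (∑-cong (allFin n) λ j → ℕ.*-identityʳ _) (∑-residues-δ (right x +ℤ q))) ⟩
      ∑[ x ∈ X ] ∑[ q ∈ Q ] 1
        ≡⟨ ∑-cong X (λ _ → ∑-1 Q) ⟩
      ∑[ x ∈ X ] length Q
        ≡⟨ ∑-const X (length Q) ⟩
      length X * length Q ∎
      where open ≡-Reasoning

    Borders⇒|P|*|Q|≡n : ∀ P X Q → length X ≡ n → Borders n P X Q → length P * length Q ≡ n
    Borders⇒|P|*|Q|≡n P X Q |X|≡n borders = ℕ.*-cancelˡ-≡ (length P * length Q) n n (begin
      n * (length P * length Q)                       ≡⟨ x∙yz≈y∙xz n (length P) (length Q) ⟩
      length P * (n * length Q)                       ≡⟨ cong (λ m → length P * (m * length Q)) |X|≡n ⟨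
      length P * (length X * length Q)                ≡⟨ cong (length P *_) (∑-length-prefixes X Q) ⟨
      length P * ∑[ j ∈ allFin n ] length (prefixes X Q j) ≡⟨ ∑-*ˡ (allFin n) (length P) _ ⟨
      ∑[ j ∈ allFin n ] (length P * length (prefixes X Q j))
        ≡⟨ ∑-cong (allFin n) (λ j → trans (sym (length-⊕ P (prefixes X Q j)))
             (Tiles⇒length≡n (P ⊕ prefixes X Q j) (Equivalence.to (Borders⇔Tiles-⊕prefixes P X Q) borders j))) ⟩
      ∑[ j ∈ allFin n ] n                             ≡⟨ ∑-const (allFin n) n ⟩
      length (allFin n) * n                           ≡⟨ cong (_* n) (List.length-tabulate {n = n} (λ i → i)) ⟩
      n * n                                           ∎)
      where open ≡-Reasoning

mainTheorem13 : {A : Set} (a b : A) → a ≢ b →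
    (n : ℕ) (X : List (Fin n × Fin n)) → IsCbc a b n X →
    (P Q : List ℤ) → Unique P → Unique Q → Borders n P X Q →
    Coprime (length P) (length Q) →
    IsFactorization n (scaledRange (length Q) (length P)) (scaledRange (length P) (length Q))
    × Borders n (scaledRange (length Q) (length P)) X (scaledRange (length P) (length Q))
mainTheorem13 _ _ _ zero      _ _                  _ _ _ _ _       _        = (λ ()) , (λ ())
mainTheorem13 _ _ _ n@(suc _) X (_ , |X|≡n , _) P Q _ _ borders coprime = factorization , bordersˢ
  where
  open Bordering n
  open Tilings n
  p = length P
  q = length Q
  Pˢ = scaledRange q p
  Qˢ = scaledRange p q
  n≡pq : n ≡ p * q
  n≡pq = sym (Borders⇒|P|*|Q|≡n P X Q |X|≡n borders)
  n≡qp : n ≡ q * p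
  n≡qp = trans n≡pq (ℕ.*-comm p q)

  bordersˡ : Borders n Pˢ X Q
  bordersˡ = Equivalence.from (Borders⇔Tiles-⊕prefixes Pˢ X Q) λ j →
    tiles-scaledRange q p P (prefixes X Q j) n≡qp (Coprime.sym coprime) refl
      (Equivalence.to (Borders⇔Tiles-⊕prefixes P X Q) borders j)

  bordersˢ : Borders n Pˢ X Qˢ
  bordersˢ = Equivalence.from (Borders⇔Tiles-⊕suffixes Pˢ X Qˢ) λ i →
    tiles-scaledRange p q Q (suffixes Pˢ X i) n≡pq coprime refl
      (Equivalence.to (Borders⇔Tiles-⊕suffixes Pˢ X Q) bordersˡ i)

  factorization : IsFactorization n Pˢ Qˢ
  factorization = Tiles⇒IsFactorization Pˢ Qˢ
    (tiles-scaledRange q p (scaledRange 1 p) Qˢ n≡qp (Coprime.sym coprime) (length-scaledRange 1 p)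
      (Tiles-range⊕scaledRange p q n≡pq))
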